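{- Any streaming algorithm for \textsc{Connectivity} in the AL model that works correctly on a family of graphs containing all "Simple AL-Conn" graphs $C_N(x,y)$ (for all $N$ and all $x,y\in\{0,1\}^N$) and uses $p$ passes over the stream requires $\Omega(n/p)$ bits of memory, where $n$ is the number of vertices.
   Context: For $N\ge1$ and $x,y\in\{0,1\}^N$, the graph $C_N(x,y)$ has $2N+4$ vertices $a,b,\ell_1,\dots,\ell_{N+1},r_1,\dots,r_{N+1}$ and edges: $\ell_ir_i$ for $1\le i\le N+1$; $a\ell_{N+1}$ and $br_{N+1}$; $a\ell_i$ exactly when $x_i=0$ ($1\le i\le N$); $br_i$ exactly when $y_i = 0$ ($1\le i\le N$). \textsc{Connectivity}: decide whether the graph is connected. In the Adjacency List (AL) streaming model the graph arrives as a sequence of vertices in arbitrary fixed order, each with the full list of its incident edges. A $p$-pass algorithm reads the sequence $p$ times with unlimited computation; memory is in bits. "Requires $\Omega(f)$ bits" means there is a constant $c_0>0$ such that every such algorithm uses at least $c_0f$ bits on some $n$-vertex input from the family, for all sufficiently large $n$ and all $p$. -}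

module Defs where

open import Data.Nat using (ℕ; zero; suc)
open import Data.Bool using (Bool; true; false; not; _∧_)
open import Data.Fin using (Fin; zero; suc; _≟_)
open import Data.Vec using (Vec; []; _∷_)
open import Data.List using (List; []; _∷_; map; _++_; allFin; filterᵇ; foldl)
open import Data.List.Relation.Unary.All using (All)
open import Data.List.Relation.Binary.Permutation.Propositional using (_↭_)
open import Data.Product using (_×_; _,_; proj₁)
open import Relation.Nullary.Decidable using (⌊_⌋)
open import Relation.Binary.PropositionalEquality using (_≡_)
open import Function.Bundles using (_⇔_)

data Reach {V : Set} (E : V → V → Bool) : V → V → Set where
  here : ∀ {u} → Reach E u u
  step : ∀ {u w v} → E u w ≡ true → Reach E w v → Reach E u v

Connected : {V : Set} → (V → V → Bool) → Set
Connected {V} E = (u v : V) → Reach E u v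

-- Vertices: a, b, ℓ i, r i  with i : Fin (suc N);
-- index i (0-based) stands for ℓ_{i+1}, r_{i+1}; the last index
-- (i = N) stands for ℓ_{N+1}, r_{N+1}.  So there are 2N+4 vertices.

data Vtx (N : ℕ) : Set where
  a b : Vtx N
  ℓ r : Fin (suc N) → Vtx N

allV : (N : ℕ) → List (Vtx N)
allV N = a ∷ b ∷ (map ℓ (allFin (suc N)) ++ map r (allFin (suc N)))

-- hub x i : is the hub (a for x, b for y) adjacent to ℓ_{i+1} / r_{i+1}?
-- For i < N: exactly when the bit x_{i+1} is 0 (bit 0 = false);
-- for i = N (the vertex ℓ_{N+1}/r_{N+1}): always.
hub : {N : ℕ} → Vec Bool N → Fin (suc N) → Bool
hub []       zero    = true
hub (c ∷ cs) zero    = not c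
hub (c ∷ cs) (suc i) = hub cs i

adjC : (N : ℕ) → Vec Bool N → Vec Bool N → Vtx N → Vtx N → Bool
adjC N x y (ℓ i) (r j) = ⌊ i ≟ j ⌋
adjC N x y (r i) (ℓ j) = ⌊ i ≟ j ⌋
adjC N x y a     (ℓ i) = hub x i
adjC N x y (ℓ i) a     = hub x i
adjC N x y b     (r i) = hub y i
adjC N x y (r i) b     = hub y i
adjC N x y _     _     = false

nbrs : (N : ℕ) → Vec Bool N → Vec Bool N → Vtx N → List (Vtx N)
nbrs N x y v = filterᵇ (adjC N x y v) (allV N)

Item : ℕ → Set
Item N = Vtx N × List (Vtx N)

IsALStream : (N : ℕ) → Vec Bool N → Vec Bool N → List (Item N) → Set
IsALStream N x y σ =
  (map proj₁ σ ↭ allV N) × All (λ it → proj₂' it ↭ nbrs N x y (proj₁ it)) σ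
  where
  proj₂' : Item N → List (Vtx N)
  proj₂' (_ , L) = L

-- In pass k the
-- algorithm updates its memory item by item with an arbitrary function
-- (unlimited computation); the memory is carried over between passes;
-- after the last pass the answer is an arbitrary function of the memory.

record StreamAlg (I : Set) (p s : ℕ) : Set where
  field
    init : Vec Bool s
    upd  : Fin p → Vec Bool s → I → Vec Bool s
    out  : Vec Bool s → Bool

open StreamAlg public

runPass : {I : Set} {p s : ℕ} → StreamAlg I p s → Fin p → Vec Bool s → List I → Vec Bool s
runPass A k m σ = foldl (upd A k) m σ

run : {I : Set} {p s : ℕ} → StreamAlg I p s → List I → Bool
run {p = p} A σ = out A (foldl (λ m k → runPass A k m σ) (init A) (allFin p))

SolvesConnC : (N : ℕ) {p s : ℕ} → StreamAlg (Item N) p s → Set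
SolvesConnC N A =
  (x y : Vec Bool N) (σ : List (Item N)) → IsALStream N x y σ →
  (run A σ ≡ true) ⇔ Connected (adjC N x y)

-- C_N(x,y) is connected iff every rung {ℓ i, r i} is attached to a or to b, i.e.
-- iff the bit strings x and y are disjoint.  Split the stream into Alice's half
-- (a and the ℓ i, which depend only on x) and Bob's half (b and the r i, which
-- depend only on y).  A p-pass algorithm with s bits is then a protocol whose
-- transcript has 2ps bits, and equal transcripts let the halves be mixed without
-- changing the answer.  On the fooling set {(x, ¬x)} all graphs are connected,
-- while for x ≠ x' one of C(x,¬x'), C(x',¬x) is not; so the transcripts of the
-- 2^N inputs (x, ¬x) are pairwise distinct and N ≤ 2ps.
module Submission where

open import Defs
open import Data.Bool using (Bool; true; false; not; T; T?)
open import Data.Bool.Properties using (T-≡)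
open import Data.Empty using (⊥; ⊥-elim)
open import Data.Fin using (Fin; zero; suc; _≟_; fromℕ; combine; funToFin; finToFun)
open import Data.Fin.Properties using (2↔Bool; funToFin-finToFin; finToFun-funToFin; injective⇒≤)
open import Data.List using (List; []; _∷_; map; _++_; allFin; filterᵇ; foldl; length)
open import Data.List.Properties using (map-++; map-∘; map-id; map-cong-local; foldl-++; filter-≐; length-tabulate)
open import Data.List.Relation.Unary.All using (All; []; _∷_; universal)
open import Data.List.Relation.Unary.All.Properties using (++⁺; map⁺)
open import Data.List.Relation.Binary.Permutation.Propositional using (_↭_; ↭-refl; ↭-prep)
open import Data.List.Relation.Binary.Permutation.Propositional.Properties using (shift)
open import Data.Nat using (ℕ; _+_; _*_; _^_; _≤_; _<_; z≤n; s≤s; z<s)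
open import Data.Nat.Properties
  using (≮⇒≥; <⇒≱; ^-monoʳ-<; *-identityˡ; *-distribʳ-+; *-monoʳ-≤; +-monoʳ-≤; module ≤-Reasoning)
open import Data.Nat.Tactic.RingSolver using (solve-∀)
open import Data.Product using (Σ; _×_; _,_; proj₁; proj₂)
open import Data.Sum using (_⊎_; inj₁; inj₂)
open import Data.Vec using (Vec; []; _∷_; lookup; tabulate) renaming (map to vmap; _++_ to _++ᵛ_)
open import Data.Vec.Properties using (tabulate-cong; tabulate∘lookup; lookup∘tabulate; ++-injective)
open import Function using (id; _∘_; _↔_; _⇔_; Inverse; mk⇔; Injective)
open import Function.Bundles using (mk↔ₛ′; Equivalence; Injection)
open import Function.Properties.Inverse using (↔⇒↣; ↔-sym)
open import Relation.Binary.PropositionalEquality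
  using (_≡_; _≗_; refl; sym; trans; cong; cong₂; subst; module ≡-Reasoning)
open import Relation.Nullary using (does; contradiction)
open import Relation.Nullary.Decidable using (⌊_⌋; isYes≗does; does-⇔; toWitness; fromWitness)

funToFin-cong : ∀ {m n} {f g : Fin m → Fin n} → f ≗ g → funToFin f ≡ funToFin g
funToFin-cong {ℕ.zero}  f≗g = refl
funToFin-cong {ℕ.suc m} f≗g = cong₂ combine (f≗g zero) (funToFin-cong (f≗g ∘ suc))

Bits↔Fin : ∀ n → Vec Bool n ↔ Fin (2 ^ n)
Bits↔Fin n = mk↔ₛ′ encode decode encode∘decode decode∘encode
  where
  open Inverse 2↔Bool renaming (to to toBool; from to fromBool)

  encode : Vec Bool n → Fin (2 ^ n)
  encode v = funToFin (fromBool ∘ lookup v)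

  decode : Fin (2 ^ n) → Vec Bool n
  decode i = tabulate (toBool ∘ finToFun i)

  encode∘decode : ∀ i → encode (decode i) ≡ i
  encode∘decode i = trans
    (funToFin-cong {n} λ j → trans (cong fromBool (lookup∘tabulate (toBool ∘ finToFun i) j))
                                   (strictlyInverseʳ (finToFun i j)))
    (funToFin-finToFin {n} i)

  decode∘encode : ∀ v → decode (encode v) ≡ v
  decode∘encode v = trans
    (tabulate-cong λ j → trans (cong toBool (finToFun-funToFin (fromBool ∘ lookup v) j))
                               (strictlyInverseˡ (lookup v j)))
    (tabulate∘lookup v)

^-cancelˡ-≤ : ∀ m {i j} → 1 < m → m ^ i ≤ m ^ j → i ≤ j
^-cancelˡ-≤ m 1<m mⁱ≤mʲ = ≮⇒≥ λ j<i → <⇒≱ (^-monoʳ-< m 1<m j<i) mⁱ≤mʲ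

Bits-injective⇒≤ : ∀ {m n} (f : Vec Bool m → Vec Bool n) → Injective _≡_ _≡_ f → m ≤ n
Bits-injective⇒≤ {m} {n} f f-inj = ^-cancelˡ-≤ 2 (s≤s (s≤s z≤n))
  (injective⇒≤ {f = encode.to ∘ f ∘ decode.to} λ eq → decode.injective (f-inj (encode.injective eq)))
  where
  module encode = Injection (↔⇒↣ (Bits↔Fin n))
  module decode = Injection (↔⇒↣ (↔-sym (Bits↔Fin m)))

module _ {V : Set} {E : V → V → Bool} where

  Reach-trans : ∀ {u v w} → Reach E u v → Reach E v w → Reach E u w
  Reach-trans here       q = q
  Reach-trans (step e p) q = step e (Reach-trans p q)

  Reach-sym : (∀ u v → E u v ≡ E v u) → ∀ {u v} → Reach E u v → Reach E v u
  Reach-sym E-sym here               = here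
  Reach-sym E-sym (step {u} {w} e p) = Reach-trans (Reach-sym E-sym p) (step (trans (E-sym w u) e) here)

  Reach-preserves : (P : V → Set) → (∀ {u w} → E u w ≡ true → P u → P w) →
                    ∀ {u v} → Reach E u v → P u → P v
  Reach-preserves P closed here       pu = pu
  Reach-preserves P closed (step e p) pu = Reach-preserves P closed p (closed e pu)

⌊≟⌋-sym : ∀ {n} (i j : Fin n) → ⌊ i ≟ j ⌋ ≡ ⌊ j ≟ i ⌋
⌊≟⌋-sym i j = begin
  ⌊ i ≟ j ⌋        ≡⟨ isYes≗does (i ≟ j) ⟩
  does (i ≟ j)     ≡⟨ does-⇔ (mk⇔ sym sym) (i ≟ j) (j ≟ i) ⟩
  does (j ≟ i)     ≡⟨ isYes≗does (j ≟ i) ⟨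
  ⌊ j ≟ i ⌋        ∎
  where open ≡-Reasoning

RungsAttached : ∀ {N} → Vec Bool N → Vec Bool N → Set
RungsAttached x y = ∀ i → hub x i ≡ true ⊎ hub y i ≡ true

hub-last : ∀ {N} (x : Vec Bool N) → hub x (fromℕ N) ≡ true
hub-last []       = refl
hub-last (c ∷ cs) = hub-last cs

module _ {N : ℕ} where

  adjC-sym : ∀ x y (u v : Vtx N) → adjC N x y u v ≡ adjC N x y v u
  adjC-sym x y a     a     = refl
  adjC-sym x y a     b     = refl
  adjC-sym x y a     (ℓ j) = refl
  adjC-sym x y a     (r j) = refl
  adjC-sym x y b     a     = refl
  adjC-sym x y b     b     = refl
  adjC-sym x y b     (ℓ j) = refl
  adjC-sym x y b     (r j) = refl
  adjC-sym x y (ℓ i) a     = refl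
  adjC-sym x y (ℓ i) b     = refl
  adjC-sym x y (ℓ i) (ℓ j) = refl
  adjC-sym x y (ℓ i) (r j) = ⌊≟⌋-sym i j
  adjC-sym x y (r i) a     = refl
  adjC-sym x y (r i) b     = refl
  adjC-sym x y (r i) (ℓ j) = ⌊≟⌋-sym i j
  adjC-sym x y (r i) (r j) = refl

  rung : ∀ x y (i : Fin (ℕ.suc N)) → adjC N x y (ℓ i) (r i) ≡ true
  rung x y i = Equivalence.to T-≡ (fromWitness refl)

  RungsAttached⇒Connected : ∀ {x y} → RungsAttached x y → Connected (adjC N x y)
  RungsAttached⇒Connected {x} {y} attached u v =
    Reach-trans (toA u) (Reach-sym (adjC-sym x y) (toA v))
    where
    E = adjC N x y
    last = fromℕ N

    b→a : Reach E b a
    b→a = step {w = r last} (hub-last y) (step {w = ℓ last} (rung x y last) (step (hub-last x) here))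

    toA : ∀ w → Reach E w a
    toA a = here
    toA b = b→a
    toA (ℓ i) with attached i
    ... | inj₁ ℓi-a = step ℓi-a here
    ... | inj₂ ri-b = step {w = r i} (rung x y i) (step {w = b} ri-b b→a)
    toA (r i) with attached i
    ... | inj₁ ℓi-a = step {w = ℓ i} (trans (adjC-sym x y (r i) (ℓ i)) (rung x y i)) (step ℓi-a here)
    ... | inj₂ ri-b = step {w = b} ri-b b→a

  OnRung : Fin (ℕ.suc N) → Vtx N → Set
  OnRung i (ℓ j) = j ≡ i
  OnRung i (r j) = j ≡ i
  OnRung i _     = ⊥

  detached-rung-closed : ∀ {x y} i → hub x i ≡ false → hub y i ≡ false →
                         ∀ {u w} → adjC N x y u w ≡ true → OnRung i u → OnRung i w
  detached-rung-closed i hx hy {ℓ j} {a}   e refl = contradiction (trans (sym e) hx) λ ()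
  detached-rung-closed i hx hy {ℓ j} {b}   () refl
  detached-rung-closed i hx hy {ℓ j} {ℓ k} () refl
  detached-rung-closed i hx hy {ℓ j} {r k} e refl = sym (toWitness (Equivalence.from T-≡ e))
  detached-rung-closed i hx hy {r j} {a}   () refl
  detached-rung-closed i hx hy {r j} {b}   e refl = contradiction (trans (sym e) hy) λ ()
  detached-rung-closed i hx hy {r j} {ℓ k} e refl = sym (toWitness (Equivalence.from T-≡ e))
  detached-rung-closed i hx hy {r j} {r k} () refl

  Connected⇒RungsAttached : ∀ {x y} → Connected (adjC N x y) → RungsAttached x y
  Connected⇒RungsAttached {x} {y} connected i with hub x i in hx | hub y i in hy
  ... | true  | _     = inj₁ refl
  ... | false | true  = inj₂ refl
  ... | false | false =
    ⊥-elim (Reach-preserves (OnRung i) (detached-rung-closed i hx hy) (connected (ℓ i) a) refl)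

filterᵇ-cong : ∀ {A : Set} {f g : A → Bool} → f ≗ g → filterᵇ f ≗ filterᵇ g
filterᵇ-cong {f = f} {g} f≗g =
  filter-≐ (T? ∘ f) (T? ∘ g) ((λ {w} → subst T (f≗g w)) , (λ {w} → subst T (sym (f≗g w))))

module _ {N : ℕ} where

  aSide bSide : List (Vtx N)
  aSide = a ∷ map ℓ (allFin (ℕ.suc N))
  bSide = b ∷ map r (allFin (ℕ.suc N))

  items : Vec Bool N → Vec Bool N → List (Vtx N) → List (Item N)
  items x y = map (λ v → v , nbrs N x y v)

  proj₁-items : ∀ x y vs → map proj₁ (items x y vs) ≡ vs
  proj₁-items x y vs = trans (sym (map-∘ vs)) (map-id vs)

  items-isALStream : ∀ x y → IsALStream N x y (items x y aSide ++ items x y bSide)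
  items-isALStream x y = vertices , ++⁺ (complete aSide) (complete bSide)
    where
    vertices : map proj₁ (items x y aSide ++ items x y bSide) ↭ allV N
    vertices = subst (_↭ allV N)
      (sym (trans (map-++ proj₁ (items x y aSide) _)
                  (cong₂ _++_ (proj₁-items x y aSide) (proj₁-items x y bSide))))
      (↭-prep a (shift b (map ℓ (allFin (ℕ.suc N))) (map r (allFin (ℕ.suc N)))))

    complete : ∀ vs → All (λ (v , L) → L ↭ nbrs N x y v) (items x y vs)
    complete vs = map⁺ (universal (λ _ → ↭-refl) vs)

  adjC-a-ignores-y : ∀ x y y' → adjC N x y a ≗ adjC N x y' a
  adjC-a-ignores-y x y y' a     = refl
  adjC-a-ignores-y x y y' b     = refl
  adjC-a-ignores-y x y y' (ℓ _) = refl
  adjC-a-ignores-y x y y' (r _) = refl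

  adjC-ℓ-ignores-y : ∀ x y y' i → adjC N x y (ℓ i) ≗ adjC N x y' (ℓ i)
  adjC-ℓ-ignores-y x y y' i a     = refl
  adjC-ℓ-ignores-y x y y' i b     = refl
  adjC-ℓ-ignores-y x y y' i (ℓ _) = refl
  adjC-ℓ-ignores-y x y y' i (r _) = refl

  adjC-b-ignores-x : ∀ x x' y → adjC N x y b ≗ adjC N x' y b
  adjC-b-ignores-x x x' y a     = refl
  adjC-b-ignores-x x x' y b     = refl
  adjC-b-ignores-x x x' y (ℓ _) = refl
  adjC-b-ignores-x x x' y (r _) = refl

  adjC-r-ignores-x : ∀ x x' y i → adjC N x y (r i) ≗ adjC N x' y (r i)
  adjC-r-ignores-x x x' y i a     = refl
  adjC-r-ignores-x x x' y i b     = refl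
  adjC-r-ignores-x x x' y i (ℓ _) = refl
  adjC-r-ignores-x x x' y i (r _) = refl

  items-aSide-ignores-y : ∀ x y y' → items x y aSide ≡ items x y' aSide
  items-aSide-ignores-y x y y' = map-cong-local
    (cong (a ,_) (filterᵇ-cong (adjC-a-ignores-y x y y') (allV N)) ∷
     map⁺ (universal (λ i → cong (ℓ i ,_) (filterᵇ-cong (adjC-ℓ-ignores-y x y y' i) (allV N))) _))

  items-bSide-ignores-x : ∀ x x' y → items x y bSide ≡ items x' y bSide
  items-bSide-ignores-x x x' y = map-cong-local
    (cong (b ,_) (filterᵇ-cong (adjC-b-ignores-x x x' y) (allV N)) ∷
     map⁺ (universal (λ i → cong (r i ,_) (filterᵇ-cong (adjC-r-ignores-x x x' y i) (allV N))) _))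

module _ {I : Set} {p s : ℕ} (A : StreamAlg I p s) where

  runPasses : List I → Vec Bool s → List (Fin p) → Vec Bool s
  runPasses σ = foldl (λ m k → runPass A k m σ)

  transcript : List I → List I → Vec Bool s → (ks : List (Fin p)) → Vec Bool (length ks * (s + s))
  transcript α β m []       = []
  transcript α β m (k ∷ ks) = (mα ++ᵛ mβ) ++ᵛ transcript α β mβ ks
    where
    mα = runPass A k m α
    mβ = runPass A k mα β

  runPasses-cut-paste : ∀ {α β α' β'} m ks → transcript α β m ks ≡ transcript α' β' m ks →
                        runPasses (α ++ β') m ks ≡ runPasses (α ++ β) m ks
  runPasses-cut-paste m []       _ = refl
  runPasses-cut-paste {α} {β} {α'} {β'} m (k ∷ ks) same = begin
    runPasses (α ++ β') (runPass A k m (α ++ β')) ks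
      ≡⟨ cong (λ m' → runPasses (α ++ β') m' ks) crossed ⟩
    runPasses (α ++ β') mβ ks
      ≡⟨ runPasses-cut-paste mβ ks sameRest ⟩
    runPasses (α ++ β) mβ ks
      ≡⟨ cong (λ m' → runPasses (α ++ β) m' ks) (foldl-++ (upd A k) m α β) ⟨
    runPasses (α ++ β) (runPass A k m (α ++ β)) ks
      ∎
    where
    open ≡-Reasoning
    mα  = runPass A k m α
    mβ  = runPass A k mα β
    mα' = runPass A k m α'
    mβ' = runPass A k mα' β'

    sameNow : mα ++ᵛ mβ ≡ mα' ++ᵛ mβ'
    sameNow = proj₁ (++-injective (mα ++ᵛ mβ) (mα' ++ᵛ mβ') same)

    sameα : mα ≡ mα'
    sameα = proj₁ (++-injective mα mα' sameNow)

    sameβ : mβ ≡ mβ'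
    sameβ = proj₂ (++-injective mα mα' sameNow)

    crossed : runPass A k m (α ++ β') ≡ mβ
    crossed = begin
      runPass A k m (α ++ β')  ≡⟨ foldl-++ (upd A k) m α β' ⟩
      runPass A k mα β'        ≡⟨ cong (λ m' → runPass A k m' β') sameα ⟩
      mβ'                      ≡⟨ sameβ ⟨
      mβ                       ∎

    sameRest : transcript α β mβ ks ≡ transcript α' β' mβ ks
    sameRest = trans (proj₂ (++-injective (mα ++ᵛ mβ) (mα' ++ᵛ mβ') same))
                     (cong (λ m' → transcript α' β' m' ks) (sym sameβ))

  run-cut-paste : ∀ {α β α' β'} → transcript α β (init A) (allFin p) ≡ transcript α' β' (init A) (allFin p) →
                  run A (α ++ β') ≡ run A (α ++ β)
  run-cut-paste = cong (out A) ∘ runPasses-cut-paste (init A) (allFin p)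

complement-attached : ∀ {N} (x : Vec Bool N) → RungsAttached x (vmap not x)
complement-attached []           zero    = inj₁ refl
complement-attached (false ∷ cs) zero    = inj₁ refl
complement-attached (true  ∷ cs) zero    = inj₂ refl
complement-attached (c     ∷ cs) (suc i) = complement-attached cs i

-- RungsAttached x (¬ x') says that x ≤ x' bitwise.
complement-attached-antisym : ∀ {N} (x x' : Vec Bool N) →
  RungsAttached x (vmap not x') → RungsAttached x' (vmap not x) → x ≡ x'
complement-attached-antisym []       []         h h' = refl
complement-attached-antisym (c ∷ cs) (c' ∷ cs') h h' =
  cong₂ _∷_ (bit (h zero) (h' zero)) (complement-attached-antisym cs cs' (h ∘ suc) (h' ∘ suc))
  where
  bit : ∀ {c c'} → not c ≡ true ⊎ not (not c') ≡ true → not c' ≡ true ⊎ not (not c) ≡ true → c ≡ c'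
  bit {false} {false} _ _ = refl
  bit {true}  {true}  _ _ = refl
  bit {true}  {false} (inj₁ ()) _
  bit {true}  {false} (inj₂ ()) _
  bit {false} {true}  _ (inj₁ ())
  bit {false} {true}  _ (inj₂ ())

module _ {N p s : ℕ} (A : StreamAlg (Item N) p s) (solves : SolvesConnC N A) where

  alice bob : Vec Bool N → List (Item N)
  alice x = items x (vmap not x) aSide
  bob   x = items x (vmap not x) bSide

  messages : Vec Bool N → Vec Bool (length (allFin p) * (s + s))
  messages x = transcript A (alice x) (bob x) (init A) (allFin p)

  run-items⇔Connected : ∀ x y →
                        (run A (items x y aSide ++ items x y bSide) ≡ true) ⇔ Connected (adjC N x y)
  run-items⇔Connected x y = solves x y _ (items-isALStream x y)

  same-messages⇒Connected : ∀ {x x'} → messages x ≡ messages x' → Connected (adjC N x (vmap not x'))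
  same-messages⇒Connected {x} {x'} same = Equivalence.to (run-items⇔Connected x (vmap not x')) (begin
    run A (items x (vmap not x') aSide ++ items x (vmap not x') bSide)
      ≡⟨ cong₂ (λ α β → run A (α ++ β)) (items-aSide-ignores-y x _ _) (items-bSide-ignores-x x x' _) ⟩
    run A (alice x ++ bob x')  ≡⟨ run-cut-paste A same ⟩
    run A (alice x ++ bob x)   ≡⟨ Equivalence.from (run-items⇔Connected x (vmap not x))
                                    (RungsAttached⇒Connected (complement-attached x)) ⟩
    true                       ∎)
    where open ≡-Reasoning

  messages-injective : Injective _≡_ _≡_ messages
  messages-injective {x} {x'} same = complement-attached-antisym x x'
    (Connected⇒RungsAttached (same-messages⇒Connected same))
    (Connected⇒RungsAttached (same-messages⇒Connected (sym same)))

  memory-bound : N ≤ p * (s + s)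
  memory-bound = subst (λ passes → N ≤ passes * (s + s)) (length-tabulate {n = p} id)
                       (Bits-injective⇒≤ messages messages-injective)

vertices-bound : ∀ {N p s} → 1 ≤ N → N ≤ p * (s + s) → 1 * (2 * N + 4) ≤ 12 * (p * s)
vertices-bound {N} {p} {s} 1≤N N≤2ps = begin
  1 * (2 * N + 4)     ≡⟨ *-identityˡ (2 * N + 4) ⟩
  2 * N + 4           ≤⟨ +-monoʳ-≤ (2 * N) (*-monoʳ-≤ 4 1≤N) ⟩
  2 * N + 4 * N       ≡⟨ *-distribʳ-+ N 2 4 ⟨
  6 * N               ≤⟨ *-monoʳ-≤ 6 N≤2ps ⟩
  6 * (p * (s + s))   ≡⟨ regroup p s ⟩
  12 * (p * s)        ∎
  where
  open ≤-Reasoning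
  regroup : ∀ p s → 6 * (p * (s + s)) ≡ 12 * (p * s)
  regroup = solve-∀

-- N₀ = 1 because C_0 is always connected; 1 ≤ p is implied by N ≤ 2ps.
theorem34 : Σ ℕ λ c → Σ ℕ λ d → (0 < c) × (0 < d) × Σ ℕ λ N₀ →
    (N : ℕ) → N₀ ≤ N → (p s : ℕ) → 1 ≤ p → (A : StreamAlg (Item N) p s) →
    SolvesConnC N A → c * (2 * N + 4) ≤ d * (p * s)
theorem34 = 1 , 12 , z<s , z<s , 1 , λ N 1≤N p s _ A solves →
  vertices-bound {p = p} {s} 1≤N (memory-bound A solves)
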